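{- Let $\omega\in\{0,1\}^{\mathbb N}$ be the binary sequence defined as follows. Then $\lim_{n\to\infty}\frac{L_n(\omega)}{\log_2 n}=\infty$. For each integer $i\ge1$ let $p_1,\dots,p_{2^i}$ be all blocks in $\{0,1\}^i$, listed in increasing order; thus $p_j$ is the $i$-digit binary notation of $j-1$, so $p_1=0^i$ and $p_{2^i}=1^i$. Let $w_i=p_1^{\lceil i2^i\log i\rceil}\,p_2^{\lceil i2^i\log i\rceil}\cdots p_{2^i}^{\lceil i2^i\log i\rceil}$. The sequence is $\omega=w_1^{l_1}w_2^{l_2}w_3^{l_3}\cdots$ with $l_i=i^{2^i}$.
   Context: For a finite block $u$ and an integer $l\ge0$, $u^l$ denotes the concatenation of $l$ copies of $u$. For a binary sequence $x$, $L_n(x)$ is the length of the longest run of consecutive ones among its first $n$ digits. -}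

module Defs where

open import Data.Nat using (ℕ; zero; suc; _+_; _*_; _∸_; _^_; _≤_; _<_; _⊔_; _≡ᵇ_; _!)
open import Data.Nat.DivMod using (_/_; _%_)
open import Data.Bool using (Bool; true; false)
open import Data.List using (List; []; _∷_; _++_; concat; replicate; map; upTo; concatMap)
open import Data.Product using (∃-syntax; _×_)
open import Data.Sum using (_⊎_)
open import Relation.Nullary using (¬_)

-- Exponential comparisons without reals.
-- expNum x J = Σ_{j=0}^{J} x^j · J!/j!  (so expNum x J / J! is the J-th
-- Taylor partial sum of e^x).
expNum : ℕ → ℕ → ℕ
expNum x zero    = 1
expNum x (suc J) = suc J * expNum x J + x ^ suc J

-- LeExp N x  means  N ≤ e^x  (for naturals N, x).
-- For x = 0, e^0 = 1.  For x ≥ 1, e^x is irrational, so N ≤ e^x iff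
-- N < e^x iff N < (some Taylor partial sum), i.e. N · J! < expNum x J.
LeExp : ℕ → ℕ → Set
LeExp N x = (N ≤ 1) ⊎ (∃[ J ] (N * (J !) < expNum x J))

-- IsCeilMulLn m i c  means  c = ⌈ m · ln i ⌉  (i ≥ 1):
-- c is the least natural number with m · ln i ≤ c, i.e. with i^m ≤ e^c.
IsCeilMulLn : ℕ → ℕ → ℕ → Set
IsCeilMulLn m i c = LeExp (i ^ m) c × (∀ k → k < c → ¬ LeExp (i ^ m) k)

pow : List Bool → ℕ → List Bool
pow u l = concat (replicate l u)

-- i-digit binary notation of j (most significant digit first; true = 1)
bits : ℕ → ℕ → List Bool
bits zero    j = []
bits (suc i) j = bits i (j / 2) ++ ((j % 2 ≡ᵇ 1) ∷ [])

-- w_i = p_1^{c i} p_2^{c i} ... p_{2^i}^{c i},  p_{j+1} = bits i j,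
-- where c i is to be ⌈ i 2^i log i ⌉.
w : (ℕ → ℕ) → ℕ → List Bool
w c i = concatMap (λ j → pow (bits i j) (c i)) (upTo (2 ^ i))

prefix : (ℕ → ℕ) → ℕ → List Bool
prefix c zero    = []
prefix c (suc k) = prefix c k ++ pow (w c (suc k)) (suc k ^ (2 ^ suc k))

nth : List Bool → ℕ → Bool
nth []       n       = false
nth (x ∷ xs) zero    = x
nth (x ∷ xs) (suc n) = nth xs n

-- ω(n) (0-based).  prefix c (n + 2) already has length > n since
-- w_i is nonempty for i ≥ 2, so the default is never used.
ω : (ℕ → ℕ) → ℕ → Bool
ω c n = nth (prefix c (n + 2)) n

runGo : ℕ → ℕ → List Bool → ℕ
runGo cur best []           = best
runGo cur best (true ∷ xs)  = runGo (suc cur) (best ⊔ suc cur) xs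
runGo cur best (false ∷ xs) = runGo 0 best xs

longestRun : List Bool → ℕ
longestRun = runGo 0 0

L : ℕ → (ℕ → Bool) → ℕ
L n x = longestRun (map x (upTo n))

module Submission where

-- Every w_k ends with its last block p_{2^k}^{c_k} = 1^{k c_k}, so as soon as n passes the first
-- copy of w_k inside w_k^{l_k} we have L_n(ω) ≥ k c_k ≥ k² 2^k.  Until the run inside w_{k+1}
-- is reached, n stays below the length of w_1^{l_1} ⋯ w_{k+1}^{l_{k+1}}, which is at most
-- 2^{(k+7) 2^{k+1}} because c_i ≤ i² 2^i.  So M log₂ n ≤ L_n(ω) for large n.  Both bounds on
-- c_k = ⌈k 2^k ln k⌉ come from Taylor partial sums of e^x: they stay below 2·16^x (whence
-- c_k ≥ k 2^k once k ≥ 16), and the single term (m i)^m/m! is already ≥ i^m (whence c_k ≤ k² 2^k).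

open import Defs
open import Data.Nat
  using (ℕ; zero; suc; _+_; _*_; _∸_; _^_; _≤_; _<_; _⊔_; _≡ᵇ_; _!; z≤n; s≤s; z<s; s<s; _≤?_; _<?_; >-nonZero)
open import Data.Nat.Properties
open import Data.Nat.DivMod using (_/_; _%_; m*n/n≡m; +-distrib-/-∣ʳ; [m+kn]%n≡m%n)
open import Data.Nat.Divisibility using (divides-refl)
open import Data.Nat.Tactic.RingSolver using (solve-∀)
open import Data.Bool using (Bool; true; false)
open import Data.List using (List; []; _∷_; _++_; [_]; replicate; map; upTo; applyUpTo; concatMap; length)
open import Data.List.Properties
  using ( length-++; length-++-≤ˡ; length-++-≤ʳ; length-replicate; length-upTo; upTo-∷ʳ; map-upTo
        ; concatMap-++; ++-identityʳ; ++-assoc)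
open import Data.Product using (∃-syntax; _×_; _,_; proj₁)
open import Data.Sum using (inj₁; inj₂)
open import Function using (_∘′_)
open import Relation.Binary.PropositionalEquality hiding ([_])
open import Relation.Nullary using (yes; no; contradiction)

^-distrib-* : ∀ m n k → (m * n) ^ k ≡ m ^ k * n ^ k
^-distrib-* m n zero    = refl
^-distrib-* m n (suc k) = trans (cong (m * n *_) (^-distrib-* m n k)) (interchange m n (m ^ k) (n ^ k))
  where
  interchange : ∀ a b c d → a * b * (c * d) ≡ a * c * (b * d)
  interchange = solve-∀

2^a+2^a≡2^[1+a] : ∀ a → 2 ^ a + 2 ^ a ≡ 2 ^ suc a
2^a+2^a≡2^[1+a] a = cong (2 ^ a +_) (sym (+-identityʳ (2 ^ a)))

n≤2^n : ∀ n → n ≤ 2 ^ n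
n≤2^n zero    = z≤n
n≤2^n (suc n) = ≤-trans (+-mono-≤ (m^n>0 2 n) (n≤2^n n)) (≤-reflexive (2^a+2^a≡2^[1+a] n))

m^n*m!≤[m+n]! : ∀ m n → m ^ n * m ! ≤ (m + n) !
m^n*m!≤[m+n]! m zero    = ≤-reflexive (trans (*-identityˡ (m !)) (cong _! (sym (+-identityʳ m))))
m^n*m!≤[m+n]! m (suc n) = begin
  m * m ^ n * m !         ≡⟨ *-assoc m (m ^ n) (m !) ⟩
  m * (m ^ n * m !)       ≤⟨ *-mono-≤ (m≤n⇒m≤1+n (m≤m+n m n)) (m^n*m!≤[m+n]! m n) ⟩
  suc (m + n) * (m + n) ! ≡⟨ cong _! (sym (+-suc m n)) ⟩
  (m + suc n) !           ∎
  where open ≤-Reasoning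

-- (m+n choose m) ≤ 2^{m+n}, by induction along Pascal's rule.
[m+n]!≤m!*n!*2^[m+n] : ∀ m n → (m + n) ! ≤ m ! * n ! * 2 ^ (m + n)
[m+n]!≤m!*n!*2^[m+n] zero n = subst (_≤ 1 * n ! * 2 ^ n) (*-identityˡ (n !))
  (m≤m*n (1 * n !) (2 ^ n) {{m^n≢0 2 n}})
[m+n]!≤m!*n!*2^[m+n] m@(suc _) zero = subst (λ k → k ! ≤ m ! * 1 * 2 ^ k) (sym (+-identityʳ m))
  (subst (_≤ m ! * 1 * 2 ^ m) (*-identityʳ (m !)) (m≤m*n (m ! * 1) (2 ^ m) {{m^n≢0 2 m}}))
[m+n]!≤m!*n!*2^[m+n] (suc m) (suc n) = begin
  (suc m + suc n) * k !                         ≡⟨ *-distribʳ-+ (k !) (suc m) (suc n) ⟩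
  suc m * k ! + suc n * k !                     ≤⟨ +-mono-≤ (*-monoʳ-≤ (suc m) ([m+n]!≤m!*n!*2^[m+n] m (suc n)))
                                                            (*-monoʳ-≤ (suc n) right) ⟩
  suc m * (m ! * (suc n * n !) * 2 ^ k) + suc n * (suc m * m ! * n ! * 2 ^ k)
                                                ≡⟨ pascal m n (m !) (n !) (2 ^ k) ⟩
  suc m * m ! * (suc n * n !) * (2 * 2 ^ k)     ∎
  where
  open ≤-Reasoning
  k = m + suc n
  right : k ! ≤ suc m ! * n ! * 2 ^ k
  right = subst (λ i → i ! ≤ suc m ! * n ! * 2 ^ i) (sym (+-suc m n)) ([m+n]!≤m!*n!*2^[m+n] (suc m) n)
  pascal : ∀ m n A B P → suc m * (A * (suc n * B) * P) + suc n * (suc m * A * B * P)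
                       ≡ suc m * A * (suc n * B) * (2 * P)
  pascal = solve-∀

m^n≤n!*2^[m+n] : ∀ m n → m ^ n ≤ n ! * 2 ^ (m + n)
m^n≤n!*2^[m+n] m n = *-cancelʳ-≤ (m ^ n) (n ! * 2 ^ (m + n)) (m !) {{m !≢0}} (begin
  m ^ n * m !                ≤⟨ m^n*m!≤[m+n]! m n ⟩
  (m + n) !                  ≤⟨ [m+n]!≤m!*n!*2^[m+n] m n ⟩
  m ! * n ! * 2 ^ (m + n)    ≡⟨ rotate (m !) (n !) (2 ^ (m + n)) ⟩
  n ! * 2 ^ (m + n) * m !    ∎)
  where
  open ≤-Reasoning
  rotate : ∀ a b c → a * b * c ≡ b * c * a
  rotate = solve-∀

2^n*m^n≤n!*16^m : ∀ m n → 2 ^ n * m ^ n ≤ n ! * 16 ^ m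
2^n*m^n≤n!*16^m m n = *-cancelʳ-≤ (2 ^ n * m ^ n) (n ! * 16 ^ m) (2 ^ n) {{m^n≢0 2 n}} (begin
  2 ^ n * m ^ n * 2 ^ n        ≡⟨ rotate (2 ^ n) (m ^ n) ⟩
  2 ^ n * 2 ^ n * m ^ n        ≡⟨ cong (_* m ^ n) (sym (^-distrib-* 2 2 n)) ⟩
  4 ^ n * m ^ n                ≡⟨ sym (^-distrib-* 4 m n) ⟩
  (4 * m) ^ n                  ≤⟨ m^n≤n!*2^[m+n] (4 * m) n ⟩
  n ! * 2 ^ (4 * m + n)        ≡⟨ cong (n ! *_) (^-distribˡ-+-* 2 (4 * m) n) ⟩
  n ! * (2 ^ (4 * m) * 2 ^ n)  ≡⟨ cong (λ e → n ! * (e * 2 ^ n)) (sym (^-*-assoc 2 4 m)) ⟩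
  n ! * (16 ^ m * 2 ^ n)       ≡⟨ sym (*-assoc (n !) (16 ^ m) (2 ^ n)) ⟩
  n ! * 16 ^ m * 2 ^ n         ∎)
  where
  open ≤-Reasoning
  rotate : ∀ a b → a * b * a ≡ a * a * b
  rotate = solve-∀

n!≤n^n : ∀ n → n ! ≤ n ^ n
n!≤n^n zero    = ≤-refl
n!≤n^n (suc n) = *-monoʳ-≤ (suc n) (≤-trans (n!≤n^n n) (^-monoˡ-≤ n (n≤1+n n)))

-- Σ_{j ≤ J} x^j / j! ≤ (2 − 2^{-J}) 16^x, multiplied through by 2^J J!.
expNum-geometric : ∀ x J → 2 ^ J * expNum x J + J ! * 16 ^ x ≤ 2 ^ suc J * (J ! * 16 ^ x)
expNum-geometric x zero = subst₂ _≤_ (left (16 ^ x)) (right (16 ^ x)) (+-monoˡ-≤ (16 ^ x) (m^n>0 16 x))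
  where
  left : ∀ G → 1 + G ≡ 1 * 1 + 1 * G
  left = solve-∀
  right : ∀ G → G + G ≡ 2 * (1 * G)
  right = solve-∀
expNum-geometric x (suc J) = begin
  2 * p * (suc J * E + x ^ suc J) + suc J * F * G  ≡⟨ expand p (suc J) E (x ^ suc J) F G ⟩
  2 * suc J * (p * E) + 2 ^ suc J * x ^ suc J + suc J * F * G
                                                   ≤⟨ +-monoˡ-≤ (suc J * F * G)
                                                        (+-monoʳ-≤ (2 * suc J * (p * E)) (2^n*m^n≤n!*16^m x (suc J))) ⟩
  2 * suc J * (p * E) + suc J * F * G + suc J * F * G
                                                   ≡⟨ collect p (suc J) E F G ⟩
  2 * suc J * (p * E + F * G)                      ≤⟨ *-monoʳ-≤ (2 * suc J) (expNum-geometric x J) ⟩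
  2 * suc J * (2 * p * (F * G))                    ≡⟨ regroup p (suc J) F G ⟩
  2 * (2 * p) * (suc J * F * G)                    ∎
  where
  open ≤-Reasoning
  p = 2 ^ J
  E = expNum x J
  F = J !
  G = 16 ^ x
  expand : ∀ p s E t F G → 2 * p * (s * E + t) + s * F * G ≡ 2 * s * (p * E) + 2 * p * t + s * F * G
  expand = solve-∀
  collect : ∀ p s E F G → 2 * s * (p * E) + s * F * G + s * F * G ≡ 2 * s * (p * E + F * G)
  collect = solve-∀
  regroup : ∀ p s F G → 2 * s * (2 * p * (F * G)) ≡ 2 * (2 * p) * (s * F * G)
  regroup = solve-∀

expNum<J!*[2*16^x] : ∀ x J → expNum x J < J ! * (2 * 16 ^ x)
expNum<J!*[2*16^x] x J = *-cancelˡ-< (2 ^ J) (expNum x J) (J ! * (2 * 16 ^ x)) (begin-strict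
  2 ^ J * expNum x J                 <⟨ m<m+n (2 ^ J * expNum x J) (*-mono-≤ (1≤n! J) (m^n>0 16 x)) ⟩
  2 ^ J * expNum x J + J ! * 16 ^ x  ≤⟨ expNum-geometric x J ⟩
  2 * 2 ^ J * (J ! * 16 ^ x)         ≡⟨ regroup (2 ^ J) (J !) (16 ^ x) ⟩
  2 ^ J * (J ! * (2 * 16 ^ x))       ∎)
  where
  open ≤-Reasoning
  regroup : ∀ p F G → 2 * p * (F * G) ≡ p * (F * (2 * G))
  regroup = solve-∀

LeExp⇒<2*16^x : ∀ {N x} → LeExp N x → N < 2 * 16 ^ x
LeExp⇒<2*16^x {x = x} (inj₁ N≤1) = ≤-<-trans N≤1 (*-monoʳ-≤ 2 (m^n>0 16 x))
LeExp⇒<2*16^x {N} {x} (inj₂ (J , N*J!<)) =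
  *-cancelˡ-< (J !) N (2 * 16 ^ x) (≤-trans (≤-reflexive (cong suc (*-comm (J !) N)))
                                           (<-trans N*J!< (expNum<J!*[2*16^x] x J)))

LeExp[k^m,x]⇒m≤x : ∀ {k m x} → 16 ≤ k → LeExp (k ^ m) x → m ≤ x
LeExp[k^m,x]⇒m≤x {k} {m} {x} 16≤k k^m≤eˣ with m ≤? x
... | yes m≤x = m≤x
... | no m≰x  = contradiction (LeExp⇒<2*16^x k^m≤eˣ) (≤⇒≯ (begin
  2 * 16 ^ x   ≤⟨ *-monoˡ-≤ (16 ^ x) {2} {16} (s≤s (s≤s z≤n)) ⟩
  16 ^ suc x   ≤⟨ ^-monoʳ-≤ 16 (≰⇒> m≰x) ⟩
  16 ^ m       ≤⟨ ^-monoˡ-≤ m 16≤k ⟩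
  k ^ m        ∎))
  where open ≤-Reasoning

LeExp[i^m,m*i] : ∀ i m → LeExp (i ^ m) (m * i)
LeExp[i^m,m*i] i zero    = inj₁ ≤-refl
LeExp[i^m,m*i] i m@(suc k) = inj₂ (m , (begin-strict
  i ^ m * m !                  ≤⟨ *-monoʳ-≤ (i ^ m) (n!≤n^n m) ⟩
  i ^ m * m ^ m                ≡⟨ *-comm (i ^ m) (m ^ m) ⟩
  m ^ m * i ^ m                ≡⟨ sym (^-distrib-* m i m) ⟩
  (m * i) ^ m                  <⟨ m<n+m ((m * i) ^ m) (*-mono-≤ {1} {m} (s≤s z≤n) (expNum-pos (m * i) k)) ⟩
  m * expNum (m * i) k + (m * i) ^ m ∎))
  where
  open ≤-Reasoning
  expNum-pos : ∀ x J → 1 ≤ expNum x J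
  expNum-pos x zero    = ≤-refl
  expNum-pos x (suc J) = ≤-trans (*-mono-≤ {1} {suc J} (s≤s z≤n) (expNum-pos x J)) (m≤m+n _ _)

IsCeilMulLn⇒c≤m*i : ∀ {m i c} → IsCeilMulLn m i c → c ≤ m * i
IsCeilMulLn⇒c≤m*i {m} {i} {c} (_ , minimal) with c ≤? m * i
... | yes c≤m*i = c≤m*i
... | no c≰m*i  = contradiction (LeExp[i^m,m*i] i m) (minimal (m * i) (≰⇒> c≰m*i))

crossing : ∀ (f : ℕ → ℕ) a d {n} → f a ≤ n → n < f (a + d) →
           ∃[ j ] (a ≤ j × f j ≤ n × n < f (suc j))
crossing f a zero    {n} fa≤n n<f = contradiction (subst (λ m → n < f m) (+-identityʳ a) n<f) (≤⇒≯ fa≤n)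
crossing f a (suc d) {n} fa≤n n<f with n <? f (a + d)
... | yes n<f′ = crossing f a d fa≤n n<f′
... | no  n≮f′ = a + d , m≤m+n a d , ≮⇒≥ n≮f′ , subst (λ m → n < f m) (+-suc a d) n<f

replicate-+ : ∀ {A : Set} m n (x : A) → replicate m x ++ replicate n x ≡ replicate (m + n) x
replicate-+ zero    n x = refl
replicate-+ (suc m) n x = cong (x ∷_) (replicate-+ m n x)

pow-replicate : ∀ m n (x : Bool) → pow (replicate n x) m ≡ replicate (m * n) x
pow-replicate zero    n x = refl
pow-replicate (suc m) n x = trans (cong (replicate n x ++_) (pow-replicate m n x)) (replicate-+ n (m * n) x)

pow-suc : ∀ u {l} → 1 ≤ l → ∃[ v ] pow u l ≡ u ++ v
pow-suc u {suc l} _ = pow u l , refl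

length-pow : ∀ u l → length (pow u l) ≡ l * length u
length-pow u zero    = refl
length-pow u (suc l) = trans (length-++ u) (cong (length u +_) (length-pow u l))

length-concatMap-const : ∀ {A B : Set} (f : A → List B) {k} xs → (∀ x → length (f x) ≡ k) →
                         length (concatMap f xs) ≡ length xs * k
length-concatMap-const f []       _       = refl
length-concatMap-const f (x ∷ xs) |fx|≡k =
  trans (length-++ (f x)) (cong₂ _+_ (|fx|≡k x) (length-concatMap-const f xs |fx|≡k))

applyUpTo-+ : ∀ {A : Set} (f : ℕ → A) m n →
              applyUpTo f (m + n) ≡ applyUpTo f m ++ applyUpTo (λ i → f (m + i)) n
applyUpTo-+ f zero    n = refl
applyUpTo-+ f (suc m) n = cong (f 0 ∷_) (applyUpTo-+ (λ i → f (suc i)) m n)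

applyUpTo-replicate : ∀ {A : Set} {x : A} (f : ℕ → A) n → (∀ i → i < n → f i ≡ x) →
                      applyUpTo f n ≡ replicate n x
applyUpTo-replicate f zero    _    = refl
applyUpTo-replicate f (suc n) f≡x =
  cong₂ _∷_ (f≡x 0 z<s) (applyUpTo-replicate (λ i → f (suc i)) n (λ i i<n → f≡x (suc i) (s<s i<n)))

nth-++ˡ : ∀ xs ys {p} → p < length xs → nth (xs ++ ys) p ≡ nth xs p
nth-++ˡ (x ∷ xs) ys {zero}  _         = refl
nth-++ˡ (x ∷ xs) ys {suc p} (s<s p<n) = nth-++ˡ xs ys p<n

nth-++ʳ : ∀ xs ys i → nth (xs ++ ys) (length xs + i) ≡ nth ys i
nth-++ʳ []       ys i = refl
nth-++ʳ (x ∷ xs) ys i = nth-++ʳ xs ys i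

nth-replicate : ∀ r ys {i} → i < r → nth (replicate r true ++ ys) i ≡ true
nth-replicate (suc r) ys {zero}  _         = refl
nth-replicate (suc r) ys {suc i} (s<s i<r) = nth-replicate r ys i<r

runGo-best : ∀ cur best xs → best ≤ runGo cur best xs
runGo-best cur best []           = ≤-refl
runGo-best cur best (true ∷ xs)  = ≤-trans (m≤m⊔n best (suc cur)) (runGo-best (suc cur) (best ⊔ suc cur) xs)
runGo-best cur best (false ∷ xs) = runGo-best 0 best xs

runGo-ones : ∀ r ys {cur best} → cur ≤ best → cur + r ≤ runGo cur best (replicate r true ++ ys)
runGo-ones zero    ys {cur} {best} cur≤best =
  ≤-trans (≤-reflexive (+-identityʳ cur)) (≤-trans cur≤best (runGo-best cur best ys))
runGo-ones (suc r) ys {cur} {best} _ =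
  subst (_≤ runGo (suc cur) (best ⊔ suc cur) (replicate r true ++ ys)) (sym (+-suc cur r))
    (runGo-ones r ys (m≤n⊔m best (suc cur)))

runGo-block : ∀ xs r ys {cur best} → cur ≤ best → r ≤ runGo cur best (xs ++ replicate r true ++ ys)
runGo-block []           r ys {cur} cur≤best = ≤-trans (m≤n+m r cur) (runGo-ones r ys cur≤best)
runGo-block (true ∷ xs)  r ys {cur} {best} _ = runGo-block xs r ys (m≤n⊔m best (suc cur))
runGo-block (false ∷ xs) r ys _              = runGo-block xs r ys z≤n

ones⇒≤L : ∀ (f : ℕ → Bool) {a r n} → (∀ i → i < r → f (a + i) ≡ true) → a + r ≤ n → r ≤ L n f
ones⇒≤L f {a} {r} {n} ones a+r≤n =
  subst (λ xs → r ≤ longestRun xs) (sym listing) (runGo-block (applyUpTo f a) r rest z≤n)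
  where
  open ≡-Reasoning
  s = n ∸ (a + r)
  g = λ i → f (a + i)
  rest = applyUpTo (λ i → g (r + i)) s
  n≡a+[r+s] : n ≡ a + (r + s)
  n≡a+[r+s] = trans (sym (m+[n∸m]≡n a+r≤n)) (+-assoc a r s)
  listing : map f (upTo n) ≡ applyUpTo f a ++ replicate r true ++ rest
  listing = begin
    map f (upTo n)                                      ≡⟨ map-upTo f n ⟩
    applyUpTo f n                                       ≡⟨ cong (applyUpTo f) n≡a+[r+s] ⟩
    applyUpTo f (a + (r + s))                           ≡⟨ applyUpTo-+ f a (r + s) ⟩
    applyUpTo f a ++ applyUpTo g (r + s)                ≡⟨ cong (applyUpTo f a ++_) (applyUpTo-+ g r s) ⟩
    applyUpTo f a ++ applyUpTo g r ++ rest              ≡⟨ cong (λ xs → applyUpTo f a ++ xs ++ rest) (applyUpTo-replicate g r ones) ⟩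
    applyUpTo f a ++ replicate r true ++ rest           ∎

length-bits : ∀ i j → length (bits i j) ≡ i
length-bits zero    j = refl
length-bits (suc i) j = trans (length-++ (bits i (j / 2))) (trans (cong (_+ 1) (length-bits i (j / 2))) (+-comm i 1))

2^[1+i]∸1≡1+[2^i∸1]*2 : ∀ i → 2 ^ suc i ∸ 1 ≡ 1 + (2 ^ i ∸ 1) * 2
2^[1+i]∸1≡1+[2^i∸1]*2 i = begin
  2 * 2 ^ i ∸ 1         ≡⟨ cong (λ p → 2 * p ∸ 1) (sym (m+[n∸m]≡n (m^n>0 2 i))) ⟩
  2 * suc t ∸ 1         ≡⟨ cong (_∸ 1) (*-comm 2 (suc t)) ⟩
  1 + t * 2             ∎
  where
  open ≡-Reasoning
  t = 2 ^ i ∸ 1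

bits-ones : ∀ i → bits i (2 ^ i ∸ 1) ≡ replicate i true
bits-ones zero    = refl
bits-ones (suc i) = begin
  bits (suc i) (2 ^ suc i ∸ 1)                       ≡⟨ cong (bits (suc i)) (2^[1+i]∸1≡1+[2^i∸1]*2 i) ⟩
  bits i ((1 + t * 2) / 2) ++ [ (1 + t * 2) % 2 ≡ᵇ 1 ] ≡⟨ cong₂ (λ q b → bits i q ++ [ b ≡ᵇ 1 ]) halve ([m+kn]%n≡m%n 1 t 2) ⟩
  bits i t ++ [ true ]                               ≡⟨ cong (_++ [ true ]) (bits-ones i) ⟩
  replicate i true ++ replicate 1 true               ≡⟨ replicate-+ i 1 true ⟩
  replicate (i + 1) true                             ≡⟨ cong (λ k → replicate k true) (+-comm i 1) ⟩
  replicate (suc i) true                             ∎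
  where
  open ≡-Reasoning
  t = 2 ^ i ∸ 1
  halve : (1 + t * 2) / 2 ≡ t
  halve = trans (+-distrib-/-∣ʳ 1 {d = 2} (divides-refl t)) (m*n/n≡m t 2)

module Sequence (c : ℕ → ℕ) where

  block : ℕ → ℕ → List Bool
  block i j = pow (bits i j) (c i)

  wInit : ℕ → List Bool
  wInit i = concatMap (block i) (upTo (2 ^ i ∸ 1))

  w≡wInit++ones : ∀ i → w c i ≡ wInit i ++ replicate (c i * i) true
  w≡wInit++ones i = begin
    concatMap (block i) (upTo (2 ^ i))              ≡⟨ cong (concatMap (block i) ∘′ upTo) (sym (m+[n∸m]≡n (m^n>0 2 i))) ⟩
    concatMap (block i) (upTo (suc t))              ≡⟨ cong (concatMap (block i)) (sym (upTo-∷ʳ t)) ⟩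
    concatMap (block i) (upTo t ++ [ t ])           ≡⟨ concatMap-++ (block i) (upTo t) [ t ] ⟩
    wInit i ++ (block i t ++ [])                    ≡⟨ cong (wInit i ++_) (++-identityʳ (block i t)) ⟩
    wInit i ++ pow (bits i t) (c i)                 ≡⟨ cong (λ u → wInit i ++ pow u (c i)) (bits-ones i) ⟩
    wInit i ++ pow (replicate i true) (c i)         ≡⟨ cong (wInit i ++_) (pow-replicate (c i) i true) ⟩
    wInit i ++ replicate (c i * i) true             ∎
    where
    open ≡-Reasoning
    t = 2 ^ i ∸ 1

  length-w : ∀ i → length (w c i) ≡ 2 ^ i * (c i * i)
  length-w i = trans (length-concatMap-const (block i) (upTo (2 ^ i)) length-block)
                     (cong (_* (c i * i)) (length-upTo (2 ^ i)))
    where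
    length-block : ∀ j → length (block i j) ≡ c i * i
    length-block j = trans (length-pow (bits i j) (c i)) (cong (c i *_) (length-bits i j))

  length-w≤length-prefix : ∀ j → length (w c (suc j)) ≤ length (prefix c (suc j))
  length-w≤length-prefix j = begin
    length W                  ≤⟨ m≤n*m (length W) l {{m^n≢0 (suc j) (2 ^ suc j)}} ⟩
    l * length W              ≡⟨ sym (length-pow W l) ⟩
    length (pow W l)          ≤⟨ length-++-≤ʳ (pow W l) {prefix c j} ⟩
    length (prefix c (suc j)) ∎
    where
    open ≤-Reasoning
    W = w c (suc j)
    l = suc j ^ 2 ^ suc j

  prefix-+ : ∀ k d → ∃[ v ] prefix c (k + d) ≡ prefix c k ++ v
  prefix-+ k zero    = [] , trans (cong (prefix c) (+-identityʳ k)) (sym (++-identityʳ (prefix c k)))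
  prefix-+ k (suc d) with prefix-+ k d
  ... | v , eq = v ++ segment , trans (cong (prefix c) (+-suc k d))
                                      (trans (cong (_++ segment) eq) (++-assoc (prefix c k) v segment))
    where segment = pow (w c (suc (k + d))) (suc (k + d) ^ 2 ^ suc (k + d))

  ω≡nth-prefix : ∀ {k p} → k ≤ p + 2 → p < length (prefix c k) → ω c p ≡ nth (prefix c k) p
  ω≡nth-prefix {k} {p} k≤p+2 p<len with prefix-+ k (p + 2 ∸ k)
  ... | v , eq = begin
    nth (prefix c (p + 2)) p               ≡⟨ cong (λ n → nth (prefix c n) p) (sym (m+[n∸m]≡n k≤p+2)) ⟩
    nth (prefix c (k + (p + 2 ∸ k))) p     ≡⟨ cong (λ xs → nth xs p) eq ⟩
    nth (prefix c k ++ v) p                ≡⟨ nth-++ˡ (prefix c k) v p<len ⟩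
    nth (prefix c k) p                     ∎
    where open ≡-Reasoning

  -- The first copy of w_{j+1} ends with the run 1^{(j+1) c_{j+1}} at positions runStart j, …, runEnd j ∸ 1 of ω.
  runStart : ℕ → ℕ
  runStart j = length (prefix c j ++ wInit (suc j))

  runEnd : ℕ → ℕ
  runEnd j = runStart j + c (suc j) * suc j

  prefix-run : ∀ j → ∃[ v ] prefix c (suc j) ≡
                           (prefix c j ++ wInit (suc j)) ++ replicate (c (suc j) * suc j) true ++ v
  prefix-run j with pow-suc (w c (suc j)) (m^n>0 (suc j) (2 ^ suc j))
  ... | v , eq = v , (begin
    prefix c j ++ pow W l                 ≡⟨ cong (prefix c j ++_) eq ⟩
    prefix c j ++ W ++ v                  ≡⟨ cong (λ u → prefix c j ++ u ++ v) (w≡wInit++ones (suc j)) ⟩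
    prefix c j ++ (I ++ ones) ++ v        ≡⟨ cong (prefix c j ++_) (++-assoc I ones v) ⟩
    prefix c j ++ I ++ ones ++ v          ≡⟨ sym (++-assoc (prefix c j) I (ones ++ v)) ⟩
    (prefix c j ++ I) ++ ones ++ v        ∎)
    where
    open ≡-Reasoning
    W = w c (suc j)
    l = suc j ^ 2 ^ suc j
    I = wInit (suc j)
    ones = replicate (c (suc j) * suc j) true

  runEnd≤length-prefix : ∀ j → runEnd j ≤ length (prefix c (suc j))
  runEnd≤length-prefix j with prefix-run j
  ... | v , eq = begin
    runStart j + R                              ≡⟨ cong (runStart j +_) (sym (length-replicate R)) ⟩
    runStart j + length ones                    ≤⟨ +-monoʳ-≤ (runStart j) (length-++-≤ˡ ones) ⟩
    runStart j + length (ones ++ v)             ≡⟨ sym (length-++ (prefix c j ++ wInit (suc j))) ⟩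
    length ((prefix c j ++ wInit (suc j)) ++ ones ++ v) ≡⟨ cong length (sym eq) ⟩
    length (prefix c (suc j))                   ∎
    where
    open ≤-Reasoning
    R = c (suc j) * suc j
    ones = replicate R true

  ω-run : ∀ j {i} → j ≤ runStart j → i < c (suc j) * suc j → ω c (runStart j + i) ≡ true
  ω-run j {i} j≤start i<R with prefix-run j
  ... | v , eq = begin
    ω c (runStart j + i)                          ≡⟨ ω≡nth-prefix within
                                                       (<-≤-trans (+-monoʳ-< (runStart j) i<R) (runEnd≤length-prefix j)) ⟩
    nth (prefix c (suc j)) (runStart j + i)       ≡⟨ cong (λ xs → nth xs (runStart j + i)) eq ⟩
    nth (P ++ replicate R true ++ v) (length P + i) ≡⟨ nth-++ʳ P (replicate R true ++ v) i ⟩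
    nth (replicate R true ++ v) i                 ≡⟨ nth-replicate R v i<R ⟩
    true                                          ∎
    where
    open ≡-Reasoning
    P = prefix c j ++ wInit (suc j)
    R = c (suc j) * suc j
    p = runStart j + i
    within : suc j ≤ p + 2
    within = ≤-trans (s≤s (≤-trans j≤start (m≤m+n (runStart j) i)))
                     (≤-trans (n≤1+n (suc p)) (≤-reflexive (+-comm 2 p)))

module _ (c : ℕ → ℕ) (ceil : ∀ i → 1 ≤ i → IsCeilMulLn (i * 2 ^ i) i (c i)) where
  open Sequence c

  c≤i*2^i*i : ∀ i → 1 ≤ i → c i ≤ i * 2 ^ i * i
  c≤i*2^i*i i 1≤i = IsCeilMulLn⇒c≤m*i {i * 2 ^ i} {i} (ceil i 1≤i)

  k*2^k≤c : ∀ k → 16 ≤ k → k * 2 ^ k ≤ c k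
  k*2^k≤c k 16≤k = LeExp[k^m,x]⇒m≤x 16≤k (proj₁ (ceil k (≤-trans (s≤s z≤n) 16≤k)))

  k≤c*k : ∀ k → 16 ≤ k → k ≤ c k * k
  k≤c*k k 16≤k = m≤n*m k (c k) {{>-nonZero 1≤c}}
    where
    1≤c : 1 ≤ c k
    1≤c = ≤-trans (*-mono-≤ (≤-trans (s≤s z≤n) 16≤k) (m^n>0 2 k)) (k*2^k≤c k 16≤k)

  segment-length≤ : ∀ k → 1 ≤ k → k ^ 2 ^ k * length (w c k) ≤ 2 ^ ((k + 5) * 2 ^ k)
  segment-length≤ k 1≤k = begin
    k ^ P * length (w c k)         ≡⟨ cong (k ^ P *_) (length-w k) ⟩
    k ^ P * (P * (c k * k))        ≤⟨ *-mono-≤ (^-monoˡ-≤ P k≤P) (*-monoʳ-≤ P (*-monoˡ-≤ k (c≤i*2^i*i k 1≤k))) ⟩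
    P ^ P * (P * (k * P * k * k))  ≤⟨ *-monoʳ-≤ (P ^ P) (*-monoʳ-≤ P (*-mono-≤ (*-mono-≤ (*-mono-≤ k≤P ≤-refl) k≤P) k≤P)) ⟩
    P ^ P * (P * (P * P * P * P))  ≡⟨ cong (P ^ P *_) (fifth P) ⟩
    P ^ P * P ^ 5                  ≡⟨ cong₂ _*_ (^-*-assoc 2 k P) (^-*-assoc 2 k 5) ⟩
    2 ^ (k * P) * 2 ^ (k * 5)      ≤⟨ *-monoʳ-≤ (2 ^ (k * P)) (^-monoʳ-≤ 2 (≤-trans (*-monoˡ-≤ 5 k≤P) (≤-reflexive (*-comm P 5)))) ⟩
    2 ^ (k * P) * 2 ^ (5 * P)      ≡⟨ sym (^-distribˡ-+-* 2 (k * P) (5 * P)) ⟩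
    2 ^ (k * P + 5 * P)            ≡⟨ cong (2 ^_) (sym (*-distribʳ-+ P k 5)) ⟩
    2 ^ ((k + 5) * P)              ∎
    where
    open ≤-Reasoning
    P = 2 ^ k
    k≤P = n≤2^n k
    fifth : ∀ P → P * (P * P * P * P) ≡ P * (P * (P * (P * (P * 1))))
    fifth = solve-∀

  length-prefix≤ : ∀ k → length (prefix c k) ≤ 2 ^ ((k + 6) * 2 ^ k)
  length-prefix≤ zero    = z≤n
  length-prefix≤ (suc j) = begin
    length (prefix c j ++ pow (w c k) l)     ≡⟨ length-++ (prefix c j) ⟩
    length (prefix c j) + length (pow (w c k) l) ≡⟨ cong (length (prefix c j) +_) (length-pow (w c k) l) ⟩
    length (prefix c j) + l * length (w c k) ≤⟨ +-mono-≤ (≤-trans (length-prefix≤ j) (^-monoʳ-≤ 2 earlier))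
                                                          (segment-length≤ k (s≤s z≤n)) ⟩
    2 ^ e + 2 ^ e                            ≡⟨ 2^a+2^a≡2^[1+a] e ⟩
    2 ^ suc e                                ≤⟨ ^-monoʳ-≤ 2 later ⟩
    2 ^ ((k + 6) * Q)                        ∎
    where
    open ≤-Reasoning
    k = suc j
    l = k ^ 2 ^ k
    Q = 2 ^ k
    e = (k + 5) * Q
    shift : ∀ j → j + 6 ≡ suc j + 5
    shift = solve-∀
    earlier : (j + 6) * 2 ^ j ≤ e
    earlier = *-mono-≤ (≤-reflexive (shift j)) (^-monoʳ-≤ 2 (n≤1+n j))
    next : ∀ k Q → (k + 5) * Q + Q ≡ (k + 6) * Q
    next = solve-∀
    later : suc e ≤ (k + 6) * Q
    later = ≤-trans (≤-reflexive (+-comm 1 e)) (≤-trans (+-monoʳ-≤ e (m^n>0 2 k)) (≤-reflexive (next k Q)))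

  j≤runStart : ∀ j → 16 ≤ j → j ≤ runStart j
  j≤runStart j@(suc i) 16≤j = begin
    j                          ≤⟨ k≤c*k j 16≤j ⟩
    c j * j                    ≤⟨ m≤n*m (c j * j) (2 ^ j) {{m^n≢0 2 j}} ⟩
    2 ^ j * (c j * j)          ≡⟨ sym (length-w j) ⟩
    length (w c j)             ≤⟨ length-w≤length-prefix i ⟩
    length (prefix c j)        ≤⟨ length-++-≤ˡ (prefix c j) ⟩
    runStart j                 ∎
    where open ≤-Reasoning

  j<runEnd : ∀ j → 16 ≤ j → j < runEnd j
  j<runEnd j 16≤j = ≤-trans (k≤c*k (suc j) (m≤n⇒m≤1+n 16≤j)) (m≤n+m (c (suc j) * suc j) (runStart j))

  run≤L : ∀ j {n} → 16 ≤ j → runEnd j ≤ n → c (suc j) * suc j ≤ L n (ω c)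
  run≤L j 16≤j end≤n = ones⇒≤L (ω c) (λ i i<R → ω-run j (j≤runStart j 16≤j) i<R) end≤n

  n^M≤2^run : ∀ M j {n} → 2 * M + 16 ≤ j → n < runEnd (suc j) → n ^ M ≤ 2 ^ (c (suc j) * suc j)
  n^M≤2^run M j {n} j₀≤j n<end = begin
    n ^ M                        ≤⟨ ^-monoˡ-≤ M n≤2^F ⟩
    (2 ^ F) ^ M                  ≡⟨ ^-*-assoc 2 F M ⟩
    2 ^ (F * M)                  ≤⟨ ^-monoʳ-≤ 2 F*M≤c*k ⟩
    2 ^ (c k * k)                ∎
    where
    open ≤-Reasoning
    k = suc j
    P = 2 ^ k
    F = (suc k + 6) * 2 ^ suc k
    n≤2^F : n ≤ 2 ^ F
    n≤2^F = <⇒≤ (<-≤-trans n<end (≤-trans (runEnd≤length-prefix (suc j)) (length-prefix≤ (suc k))))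
    2M≤k : 2 * M ≤ k
    2M≤k = ≤-trans (m≤m+n (2 * M) 16) (m≤n⇒m≤1+n j₀≤j)
    F*M≤c*k : F * M ≤ c k * k
    F*M≤c*k = begin
      (suc k + 6) * (2 * P) * M     ≡⟨ regroup k P M ⟩
      k * (2 * M) * P + 7 * (2 * M) * P ≤⟨ +-monoʳ-≤ (k * (2 * M) * P) (*-monoˡ-≤ P (*-monoʳ-≤ 7 2M≤k)) ⟩
      k * (2 * M) * P + 7 * k * P   ≡⟨ collect k M P ⟩
      (2 * M + 7) * (k * P)         ≤⟨ *-mono-≤ 2M+7≤k (k*2^k≤c k 16≤k) ⟩
      k * c k                       ≡⟨ *-comm k (c k) ⟩
      c k * k                       ∎
      where
      16≤k = ≤-trans (m≤n+m 16 (2 * M)) (m≤n⇒m≤1+n j₀≤j)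
      2M+7≤k = ≤-trans (+-monoʳ-≤ (2 * M) (m≤m+n 7 9)) (m≤n⇒m≤1+n j₀≤j)
      regroup : ∀ k P M → (suc k + 6) * (2 * P) * M ≡ k * (2 * M) * P + 7 * (2 * M) * P
      regroup = solve-∀
      collect : ∀ k M P → k * (2 * M) * P + 7 * k * P ≡ (2 * M + 7) * (k * P)
      collect = solve-∀

mainTheorem6 : (c : ℕ → ℕ) → (∀ i → 1 ≤ i → IsCeilMulLn (i * 2 ^ i) i (c i)) →
    ∀ M → ∃[ N ] (∀ n → N ≤ n → n ^ M ≤ 2 ^ L n (ω c))
mainTheorem6 c ceil M = runEnd j₀ , bound
  where
  open Sequence c
  j₀ = 2 * M + 16
  16≤ : ∀ {j} → j₀ ≤ j → 16 ≤ j
  16≤ = ≤-trans (m≤n+m 16 (2 * M))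
  bound : ∀ n → runEnd j₀ ≤ n → n ^ M ≤ 2 ^ L n (ω c)
  bound n end≤n = conclude (crossing runEnd j₀ n end≤n n<runEnd)
    where
    n<runEnd : n < runEnd (j₀ + n)
    n<runEnd = ≤-<-trans (m≤n+m n j₀) (j<runEnd c ceil (j₀ + n) (16≤ (m≤m+n j₀ n)))
    conclude : ∃[ j ] (j₀ ≤ j × runEnd j ≤ n × n < runEnd (suc j)) → n ^ M ≤ 2 ^ L n (ω c)
    conclude (j , j₀≤j , endⱼ≤n , n<endⱼ₊₁) =
      ≤-trans (n^M≤2^run c ceil M j j₀≤j n<endⱼ₊₁) (^-monoʳ-≤ 2 (run≤L c ceil j (16≤ j₀≤j) endⱼ≤n))
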